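{- Let \(\Delta\) be a signature, \(\Gamma\) a set of nominal or hybrid equations over \(\Delta\), and \(W\) a reachable \(\Sigma^{n}\)-model such that \(\Gamma \models \Gamma_W\), where \(\Gamma_W = \{k_1 = k_2 \mid k_1,k_2 \text{ ground nominal terms},\ W_{k_1} = W_{k_2}\}\). Then the family \(\equiv = \{\equiv_w\}_{w \in |W|}\) defined by: \(\tau_1 \equiv_w \tau_2\) iff there exist a ground nominal term \(k\) and hybrid terms \(t_1, t_2 \in T^{\Delta}_{k}\) such that \(\Gamma \models t_1 =_k t_2\), \(w = W_k\), and \(\tau_i = T^{W}_{w,t_i}\) for \(i = 1,2\), is a \(\Delta\)-congruence on the hybrid-term model \((W, T^{W})\).
   Context: Signatures: \(\Delta = (\Sigma^{n}, \Sigma^{r} \subseteq \Sigma)\), where \(\Sigma^{n} = (\{\star\}, F^{n}, P^{n})\) is a one-sorted first-order signature of nominals and \(\Sigma^{r} = (S^{r},F^{r},P^{r}) \subseteq \Sigma = (S,F,P)\) are many-sorted first-order signatures; symbols in \(\Sigma^{r}\) are rigid, the others (\(F^{f}, P^{f}\)) flexible. A \(\Delta\)-model is \((W,M)\) with \(W\) a \(\Sigma^{n}\)-model, \(|W|\) the carrier of \(\star\) (worlds), and \(M=\{M_w\}_{w\in|W|}\) \(\Sigma\)-models interpreting all rigid symbols identically. A \(\Delta\)-homomorphism \((W,M)\to(W',M')\) is a \(\Sigma^{n}\)-homomorphism \(h\colon W\to W'\) with \(\Sigma\)-homomorphisms \(h_w\colon M_w\to M'_{h(w)}\) coinciding on rigid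 sorts. A \(\Sigma^n\)-model \(W\) is reachable if the unique homomorphism from the ground-term model \(T_{\Sigma^n}\) to \(W\) is surjective; \(W_k\) denotes the value of a ground nominal term \(k\). Hybrid terms over a \(\Sigma^{n}\)-model \(W\): the least family \(T^{W}=\{T^W_w\}_{w\in|W|}\) of \(S\)-sorted sets with \(\sigma(\tau)\in T^W_{w,s}\) for rigid \(\sigma\in F^{r}_{ar\to s}\), \(\sigma(w,\tau)\in T^W_{w,s}\) for flexible \(\sigma \in F^{f}_{ar\to s}\) (\(\tau\in T^W_{w,ar}\)), and \(T^W_{w_0,s}\subseteq T^W_{w,s}\) for all worlds \(w_0,w\) and rigid sorts \(s\); each \(T^W_w\) is a \(\Sigma\)-model with the term-forming operations (rigid \(\sigma\): \(\tau\mapsto\sigma(\tau)\), flexible \(\sigma\): \(\tau\mapsto\sigma(w,\tau)\)) and empty relations; \((W,T^W)\) is a \(\Delta\)-model. The standard hybrid-term model \((T_{\Sigma^{n}},\{T^{\Delta}_k\}_{k\in T_{\Sigma^n}})\) is the case \(W = T_{\Sigma^n}\); it has a unique homomorphism \(h\) into every \(\Delta\)-model \((W',M')\), and for \(t \in T^{\Delta}_k\) one writes \((W',M')_t = h_k(t)\); in particular \(T^{W}_{w,t}\) denotes the value of \(t \in T^{\Delta}_k\) in \((W,T^W)\), lying in \(T^W_{W_k}\). Sentences used: a nominal equation \(k_1 = k_2\) (ground nominal terms) holds in \((W',M')\) iff \(W'_{k_1} = W'_{k_2}\); a hybrid equation \(t_1 =_{k} t_2\) (\(t_1,t_2 \in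 T^{\Delta}_{k,s}\)) holds iff \((W',M')_{t_1} = (W',M')_{t_2}\). A model satisfies a set of sentences iff it satisfies each one; \(\Gamma \models \Gamma'\) means every \(\Delta\)-model satisfying \(\Gamma\) satisfies \(\Gamma'\). A \(\Delta\)-congruence on a \(\Delta\)-model \((W,M)\) is a family \(\{\equiv_w\}_{w\in|W|}\) where each \(\equiv_w\) is a \(\Sigma\)-congruence on \(M_w\) (sortwise equivalence compatible with all operations of \(F\)), such that \(\equiv_{w_1,s} = \equiv_{w_2,s}\) for all \(w_1,w_2\in|W|\) and all rigid sorts \(s \in S^{r}\). -}

module Defs where

open import Level using (Level; _⊔_) renaming (suc to lsuc; zero to lzero)
open import Data.Nat using (ℕ)
open import Data.Vec using (Vec)
open import Data.List using (List; []; _∷_; map)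
open import Data.List.Relation.Unary.All using (All; []; _∷_)
open import Data.List.Relation.Unary.All.Properties using (map⁻)
open import Data.Sum using (_⊎_; inj₁; inj₂)
open import Data.Product using (Σ; ∃; _×_; _,_)
open import Data.Empty using (⊥)
open import Relation.Binary.Core using (Rel)
open import Relation.Binary.Structures using (IsEquivalence)
open import Relation.Binary.PropositionalEquality using (_≡_; subst)
open import Function.Bundles using (_⇔_)

record MSig : Set₁ where
  field
    Sort : Set
    Op   : List Sort → Sort → Set
    Pr   : List Sort → Set

record MModel (Σ' : MSig) : Set₁ where
  open MSig Σ'
  field
    Car : Sort → Set
    op  : ∀ {ar s} → Op ar s → All Car ar → Car s
    pr  : ∀ {ar} → Pr ar → All Car ar → Set

data AllRel {ℓ} {S : Set} {C : S → Set} (R : (s : S) → Rel (C s) ℓ)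
            : {ar : List S} → All C ar → All C ar → Set ℓ where
  []  : AllRel R [] []
  _∷_ : ∀ {s ar} {x y : C s} {xs ys : All C ar} →
        R s x y → AllRel R xs ys → AllRel R (x ∷ xs) (y ∷ ys)

record IsMCongruence {ℓ} {Σ' : MSig} (M : MModel Σ')
       (R : (s : MSig.Sort Σ') → Rel (MModel.Car M s) ℓ) : Set (lsuc lzero ⊔ ℓ) where
  open MSig Σ'
  open MModel M
  field
    equiv  : ∀ s → IsEquivalence (R s)
    compat : ∀ {ar s} (σ : Op ar s) {xs ys : All Car ar} →
             AllRel R xs ys → R s (op σ xs) (op σ ys)

-- Hybrid signatures Δ = (Σⁿ, Σʳ ⊆ Σ).
-- Σⁿ : one-sorted (arities are natural numbers).
-- Σ : sorts S = Sʳ ⊎ Sᶠ, function symbols F = Fʳ ⊎ Fᶠ, predicates P = Pʳ ⊎ Pᶠ,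
-- where the rigid subsignature Σʳ = (Sʳ, Fʳ, Pʳ) has arities in Sʳ.

record Sig : Set₁ where
  field
    NFn  : ℕ → Set
    NPr  : ℕ → Set
    SortR : Set
    OpR   : List SortR → SortR → Set
    PrR   : List SortR → Set
    SortF : Set
  Sort : Set
  Sort = SortR ⊎ SortF
  field
    OpF   : List Sort → Sort → Set
    PrF   : List Sort → Set

module _ (Δ : Sig) where
  open Sig Δ

  data RigidOp : List Sort → Sort → Set where
    rop : ∀ {ar r} → OpR ar r → RigidOp (map inj₁ ar) (inj₁ r)

  data RigidPr : List Sort → Set where
    rpr : ∀ {ar} → PrR ar → RigidPr (map inj₁ ar)

  SigΣ : MSig
  SigΣ = record { Sort = Sort
                ; Op = λ ar s → RigidOp ar s ⊎ OpF ar s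
                ; Pr = λ ar → RigidPr ar ⊎ PrF ar }

  record NomModel : Set₁ where
    field
      Wd  : Set
      fn  : ∀ {n} → NFn n → Vec Wd n → Wd
      pr  : ∀ {n} → NPr n → Vec Wd n → Set

  data NTerm : Set where
    app : ∀ {n} → NFn n → Vec NTerm n → NTerm

  mutual
    ⟦_⟧ₙ : NTerm → (W : NomModel) → NomModel.Wd W
    ⟦ app f ks ⟧ₙ W = NomModel.fn W f (⟦ ks ⟧ₙₛ W)

    ⟦_⟧ₙₛ : ∀ {n} → Vec NTerm n → (W : NomModel) → Vec (NomModel.Wd W) n
    ⟦ Vec.[] ⟧ₙₛ W = Vec.[]
    ⟦ k Vec.∷ ks ⟧ₙₛ W = ⟦ k ⟧ₙ W Vec.∷ ⟦ ks ⟧ₙₛ W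

  Reachable : NomModel → Set
  Reachable W = ∀ (w : NomModel.Wd W) → ∃ λ (k : NTerm) → ⟦ k ⟧ₙ W ≡ w

  -- Δ-models.  Rigid sorts/symbols are interpreted once (shared by all
  -- worlds); this is exactly "all Mw interpret rigid symbols identically".

  Glue : (SortR → Set) → (SortF → Set) → Sort → Set
  Glue R F (inj₁ r) = R r
  Glue R F (inj₂ f) = F f

  record DModel : Set₁ where
    field
      W     : NomModel
    Wd : Set
    Wd = NomModel.Wd W
    field
      RCar  : SortR → Set
      FCar  : Wd → SortF → Set
    Car : Wd → Sort → Set
    Car w = Glue RCar (FCar w)
    field
      ropI  : ∀ {ar r} → OpR ar r → All RCar ar → RCar r
      rprI  : ∀ {ar} → PrR ar → All RCar ar → Set
      fopI  : ∀ (w : Wd) {ar s} → OpF ar s → All (Car w) ar → Car w s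
      fprI  : ∀ (w : Wd) {ar} → PrF ar → All (Car w) ar → Set

    M : Wd → MModel SigΣ
    M w = record { Car = Car w ; op = opw ; pr = prw }
      where
      opw : ∀ {ar s} → (RigidOp ar s ⊎ OpF ar s) → All (Car w) ar → Car w s
      opw (inj₁ (rop σ)) xs = ropI σ (map⁻ xs)
      opw (inj₂ σ) xs = fopI w σ xs
      prw : ∀ {ar} → (RigidPr ar ⊎ PrF ar) → All (Car w) ar → Set
      prw (inj₁ (rpr π)) xs = rprI π (map⁻ xs)
      prw (inj₂ π) xs = fprI w π xs

  record IsΔCongruence {ℓ} (𝔐 : DModel)
         (R : (w : DModel.Wd 𝔐) (s : Sort) → Rel (DModel.Car 𝔐 w s) ℓ)
         : Set (lsuc lzero ⊔ ℓ) where
    open DModel 𝔐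
    field
      congruence : ∀ w → IsMCongruence (M w) (R w)
      rigid      : ∀ (w₁ w₂ : Wd) (r : SortR) (x y : RCar r) →
                   R w₁ (inj₁ r) x y ⇔ R w₂ (inj₁ r) x y

  -- Hybrid terms over a set of worlds Wd (T^W); rigid-sort terms are
  -- shared by all worlds (T^W_{w₀,s} ⊆ T^W_{w,s} for rigid s).

  module HTerms (Wd : Set) where
    mutual
      data RT : SortR → Set where
        rig   : ∀ {ar r} → OpR ar r → All RT ar → RT r
        flexR : ∀ (w₀ : Wd) {ar r} → OpF ar (inj₁ r) → All (Glue RT (FT w₀)) ar → RT r

      data FT (w : Wd) : SortF → Set where
        flex  : ∀ {ar f} → OpF ar (inj₂ f) → All (Glue RT (FT w)) ar → FT w f

    Term : Wd → Sort → Set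
    Term w = Glue RT (FT w)

    flexOp : ∀ (w : Wd) {ar s} → OpF ar s → All (Term w) ar → Term w s
    flexOp w {s = inj₁ r} σ xs = flexR w σ xs
    flexOp w {s = inj₂ f} σ xs = flex σ xs

  TW : NomModel → DModel
  TW W = record
    { W = W
    ; RCar = RT
    ; FCar = FT
    ; ropI = rig
    ; rprI = λ _ _ → ⊥
    ; fopI = flexOp
    ; fprI = λ _ _ _ → ⊥ }
    where open HTerms (NomModel.Wd W)

  open module TΔ = HTerms NTerm public
    renaming (RT to RTΔ; FT to FTΔ; Term to TermΔ; rig to rigΔ; flexR to flexRΔ; flex to flexΔ)
    using ()

  -- Value of hybrid terms in a Δ-model: the unique homomorphism h from the
  -- standard hybrid-term model, defined by structural recursion.

  module Eval (𝔐 : DModel) where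
    open DModel 𝔐
    open HTerms NTerm
    h : NTerm → Wd
    h k = ⟦ k ⟧ₙ W

    mutual
      evalR : ∀ {r} → RT r → RCar r
      evalR (rig σ xs) = ropI σ (evalRs xs)
      evalR (flexR w₀ σ xs) = fopI (h w₀) σ (evalAll w₀ xs)

      evalF : ∀ {k f} → FT k f → FCar (h k) f
      evalF {k} (flex σ xs) = fopI (h k) σ (evalAll k xs)

      eval : ∀ (k : NTerm) (s : Sort) → Term k s → Car (h k) s
      eval k (inj₁ r) t = evalR t
      eval k (inj₂ f) t = evalF t

      evalRs : ∀ {ar} → All RT ar → All RCar ar
      evalRs [] = []
      evalRs (x ∷ xs) = evalR x ∷ evalRs xs

      evalAll : ∀ (k : NTerm) {ar} → All (Term k) ar → All (Car (h k)) ar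
      evalAll k [] = []
      evalAll k (_∷_ {x = s} x xs) = eval k s x ∷ evalAll k xs

  value : (𝔐 : DModel) (k : NTerm) (s : Sort) → TermΔ k s →
          DModel.Car 𝔐 (⟦ k ⟧ₙ (DModel.W 𝔐)) s
  value 𝔐 k s t = Eval.eval 𝔐 k s t

  data Sen : Set where
    nomEq : NTerm → NTerm → Sen
    hybEq : (k : NTerm) (s : Sort) → TermΔ k s → TermΔ k s → Sen

  _⊨_ : DModel → Sen → Set
  𝔐 ⊨ nomEq k₁ k₂ = ⟦ k₁ ⟧ₙ (DModel.W 𝔐) ≡ ⟦ k₂ ⟧ₙ (DModel.W 𝔐)
  𝔐 ⊨ hybEq k s t₁ t₂ = value 𝔐 k s t₁ ≡ value 𝔐 k s t₂

  _⊨Set_ : DModel → (Sen → Set) → Set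
  𝔐 ⊨Set Γ = ∀ φ → Γ φ → 𝔐 ⊨ φ

  _⊨⊨_ : (Sen → Set) → (Sen → Set) → Set₁
  Γ ⊨⊨ Γ' = ∀ (𝔐 : DModel) → 𝔐 ⊨Set Γ → 𝔐 ⊨Set Γ'

  ΓW : NomModel → Sen → Set
  ΓW W (nomEq k₁ k₂) = ⟦ k₁ ⟧ₙ W ≡ ⟦ k₂ ⟧ₙ W
  ΓW W (hybEq _ _ _ _) = ⊥

  ⟨_⟩ : Sen → Sen → Set
  ⟨ φ ⟩ ψ = ψ ≡ φ

  HRel : (Γ : Sen → Set) (W : NomModel) (w : NomModel.Wd W) (s : Sort) →
         Rel (DModel.Car (TW W) w s) (lsuc lzero)
  HRel Γ W w s τ₁ τ₂ =
    Σ NTerm λ k → Σ (TermΔ k s) λ t₁ → Σ (TermΔ k s) λ t₂ →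
      (Γ ⊨⊨ ⟨ hybEq k s t₁ t₂ ⟩) ×
      Σ (w ≡ ⟦ k ⟧ₙ W) λ p →
        (subst (λ v → DModel.Car (TW W) v s) p τ₁ ≡ value (TW W) k s t₁) ×
        (subst (λ v → DModel.Car (TW W) v s) p τ₂ ≡ value (TW W) k s t₂)

-- Fix a model M of Γ.  Sending each world w of W to the world of M named by a chosen
-- ground nominal term k with W_k = w (reachability) is coherent with every other name of w,
-- because Γ ⊨ Γ_W; it extends to a Δ-homomorphism ι_M : (W, T^W) → M that commutes with
-- the evaluation of hybrid terms.  Hence τ₁ ≡_w τ₂ iff ι_M τ₁ = ι_M τ₂ for all models M
-- of Γ: forwards, evaluate Γ ⊨ t₁ =ₖ t₂ in M; backwards, every τ ∈ T^W_{W_k} is the value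
-- of some t ∈ T^Δ_k (reachability again).  A joint kernel of homomorphisms is a
-- congruence, and on rigid sorts ι_M does not depend on the world.
module Submission where

open import Level using (0ℓ) renaming (suc to lsuc)
open import Defs
open import Data.List using ([]; _∷_; map)
open import Data.List.Relation.Unary.All as All using (All; []; _∷_)
open import Data.List.Relation.Unary.All.Properties using (map⁻)
open import Data.Sum using (inj₁; inj₂)
open import Data.Product using (Σ; _,_; proj₁; proj₂)
open import Relation.Binary.Core using (Rel)
open import Relation.Binary.Structures using (IsEquivalence)
open import Relation.Binary.PropositionalEquality
open import Relation.Binary.PropositionalEquality.Properties
  using (subst-injective; subst-application′)
open import Function.Base using (id)
open import Function.Bundles using (_⇔_; mk⇔; Equivalence)
open import Function.Construct.Composition using (_⇔-∘_)
open import Function.Construct.Symmetry using (⇔-sym)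

module _ {Σ' : MSig} where
  open MSig Σ'
  open MModel

  IsMHomomorphism : (M N : MModel Σ') → (∀ s → Car M s → Car N s) → Set
  IsMHomomorphism M N h =
    ∀ {ar s} (σ : Op ar s) (xs : All (Car M) ar) →
    h s (op M σ xs) ≡ op N σ (All.map (h _) xs)

  AllRel-map : ∀ {ℓ ℓ′} {C : Sort → Set}
               {R : ∀ s → Rel (C s) ℓ} {R′ : ∀ s → Rel (C s) ℓ′} →
               (∀ {s x y} → R s x y → R′ s x y) →
               ∀ {ar} {xs ys : All C ar} → AllRel R xs ys → AllRel R′ xs ys
  AllRel-map f []       = []
  AllRel-map f (r ∷ rs) = f r ∷ AllRel-map f rs

  module _ {ℓ} {I : Set ℓ} (M : MModel Σ') (N : I → MModel Σ')
           (h : ∀ i s → Car M s → Car (N i) s) where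

    Kernel : ∀ s → Rel (Car M s) ℓ
    Kernel s x y = ∀ i → h i s x ≡ h i s y

    Kernel⇒map≡ : ∀ i {ar} {xs ys : All (Car M) ar} → AllRel Kernel xs ys →
                  All.map (h i _) xs ≡ All.map (h i _) ys
    Kernel⇒map≡ i []       = refl
    Kernel⇒map≡ i (r ∷ rs) = cong₂ _∷_ (r i) (Kernel⇒map≡ i rs)

    Kernel-isMCongruence : (∀ i → IsMHomomorphism M (N i) (h i)) →
                           IsMCongruence M Kernel
    Kernel-isMCongruence homo = record
      { equiv  = λ s → record
        { refl  = λ i → refl
        ; sym   = λ x≈y i → sym (x≈y i)
        ; trans = λ x≈y y≈z i → trans (x≈y i) (y≈z i) }
      ; compat = λ σ {xs} {ys} xs≈ys i → begin
          h i _ (op M σ xs)                 ≡⟨ homo i σ xs ⟩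
          op (N i) σ (All.map (h i _) xs)   ≡⟨ cong (op (N i) σ) (Kernel⇒map≡ i xs≈ys) ⟩
          op (N i) σ (All.map (h i _) ys)   ≡⟨ homo i σ ys ⟨
          h i _ (op M σ ys)                 ∎ }
      where open ≡-Reasoning

  IsMCongruence-resp-⇔ : ∀ {ℓ ℓ′} {M : MModel Σ'}
                         {R : ∀ s → Rel (Car M s) ℓ} {R′ : ∀ s → Rel (Car M s) ℓ′} →
                         (∀ s x y → R s x y ⇔ R′ s x y) →
                         IsMCongruence M R′ → IsMCongruence M R
  IsMCongruence-resp-⇔ {R = R} {R′} R⇔R′ cong′ = record
    { equiv  = λ s → record
      { refl  = from (IsEquivalence.refl (equiv s))
      ; sym   = λ r → from (IsEquivalence.sym (equiv s) (to r))
      ; trans = λ r r′ → from (IsEquivalence.trans (equiv s) (to r) (to r′)) }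
    ; compat = λ σ rs → from (compat σ (AllRel-map to rs)) }
    where
    open IsMCongruence cong′
    to : ∀ {s x y} → R s x y → R′ s x y
    to = Equivalence.to (R⇔R′ _ _ _)
    from : ∀ {s x y} → R′ s x y → R s x y
    from = Equivalence.from (R⇔R′ _ _ _)

module _ (Δ : Sig) where
  open Sig Δ

  IsΔCongruence-resp-⇔ : ∀ {ℓ ℓ′} {𝔐 : DModel Δ} →
    let open DModel 𝔐 in
    {R : ∀ w s → Rel (Car w s) ℓ} {R′ : ∀ w s → Rel (Car w s) ℓ′} →
    (∀ w s x y → R w s x y ⇔ R′ w s x y) →
    IsΔCongruence Δ 𝔐 R′ → IsΔCongruence Δ 𝔐 R
  IsΔCongruence-resp-⇔ R⇔R′ cong′ = record
    { congruence = λ w → IsMCongruence-resp-⇔ (R⇔R′ w) (congruence w)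
    ; rigid      = λ w₁ w₂ r x y →
        ⇔-sym (R⇔R′ w₂ (inj₁ r) x y) ⇔-∘ (rigid w₁ w₂ r x y ⇔-∘ R⇔R′ w₁ (inj₁ r) x y) }
    where open IsΔCongruence cong′

  module Interpretation (W : NomModel Δ) (M : DModel Δ)
                        (g : NomModel.Wd W → DModel.Wd M) where
    open HTerms Δ (NomModel.Wd W)
    private
      module M = DModel M
      module TW = DModel (TW Δ W)
      module E = Eval Δ (TW Δ W)
      module EM = Eval Δ M

    mutual
      interpR : ∀ {r} → RT r → M.RCar r
      interpR (rig σ xs)      = M.ropI σ (interpRs xs)
      interpR (flexR w₀ σ xs) = M.fopI (g w₀) σ (interpAll w₀ xs)

      interpRs : ∀ {ar} → All RT ar → All M.RCar ar
      interpRs []       = []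
      interpRs (x ∷ xs) = interpR x ∷ interpRs xs

      interpF : ∀ {w f} → FT w f → M.FCar (g w) f
      interpF {w} (flex σ xs) = M.fopI (g w) σ (interpAll w xs)

      interp : ∀ w s → Term w s → M.Car (g w) s
      interp w (inj₁ r) t = interpR t
      interp w (inj₂ f) t = interpF t

      interpAll : ∀ w {ar} → All (Term w) ar → All (M.Car (g w)) ar
      interpAll w []                  = []
      interpAll w (_∷_ {x = s} x xs) = interp w s x ∷ interpAll w xs

    interpAll≡map : ∀ w {ar} (xs : All (Term w) ar) →
                    interpAll w xs ≡ All.map (λ {s} → interp w s) xs
    interpAll≡map w []       = refl
    interpAll≡map w (x ∷ xs) = cong (_ ∷_) (interpAll≡map w xs)

    interpRs-map⁻ : ∀ w {ar} (xs : All (Term w) (map inj₁ ar)) →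
                    interpRs (map⁻ xs) ≡ map⁻ (interpAll w xs)
    interpRs-map⁻ w {[]}    []       = refl
    interpRs-map⁻ w {_ ∷ _} (x ∷ xs) = cong (_ ∷_) (interpRs-map⁻ w xs)

    interp-isMHomomorphism : ∀ w → IsMHomomorphism (TW.M w) (M.M (g w)) (interp w)
    interp-isMHomomorphism w (inj₁ (rop σ)) xs =
      cong (M.ropI σ) (trans (interpRs-map⁻ w xs) (cong map⁻ (interpAll≡map w xs)))
    interp-isMHomomorphism w {s = inj₁ r} (inj₂ σ) xs =
      cong (M.fopI (g w) σ) (interpAll≡map w xs)
    interp-isMHomomorphism w {s = inj₂ f} (inj₂ σ) xs =
      cong (M.fopI (g w) σ) (interpAll≡map w xs)

    module _ (g-ground : ∀ k → ⟦_⟧ₙ Δ k M.W ≡ g (⟦_⟧ₙ Δ k W)) where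
      private
        ⟦_⟧W : NTerm Δ → NomModel.Wd W
        ⟦ k ⟧W = ⟦_⟧ₙ Δ k W

        subst-rigid : ∀ {a b} (p : a ≡ b) {r} (x : M.RCar r) →
                      subst (λ v → M.Car v (inj₁ r)) p x ≡ x
        subst-rigid refl x = refl

        subst-[] : ∀ {a b} (p : a ≡ b) → subst (λ v → All (M.Car v) []) p [] ≡ []
        subst-[] refl = refl

        subst-∷ : ∀ {a b} (p : a ≡ b) {s ar} (x : M.Car a s) (xs : All (M.Car a) ar) →
                  subst (λ v → All (M.Car v) (s ∷ ar)) p (x ∷ xs) ≡
                  subst (λ v → M.Car v s) p x ∷ subst (λ v → All (M.Car v) ar) p xs
        subst-∷ refl x xs = refl

        fopI-subst : ∀ {a b} (p : a ≡ b) {ar s} (σ : OpF ar s) (xs : All (M.Car a) ar) →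
                     M.fopI b σ (subst (λ v → All (M.Car v) ar) p xs) ≡
                     subst (λ v → M.Car v s) p (M.fopI a σ xs)
        fopI-subst p σ xs = sym (subst-application′ _ (λ v → M.fopI v σ) p)

      mutual
        interp-valueR : ∀ {r} (t : RTΔ Δ r) → interpR (E.evalR t) ≡ EM.evalR t
        interp-valueR (rigΔ σ xs)     = cong (M.ropI σ) (interp-valueRs xs)
        interp-valueR (flexRΔ k σ xs) =
          trans (cong (M.fopI (g ⟦ k ⟧W) σ) (interp-valueAll k xs))
                (trans (fopI-subst (g-ground k) σ (EM.evalAll k xs))
                       (subst-rigid (g-ground k) _))

        interp-valueRs : ∀ {ar} (xs : All (RTΔ Δ) ar) → interpRs (E.evalRs xs) ≡ EM.evalRs xs
        interp-valueRs []       = refl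
        interp-valueRs (x ∷ xs) = cong₂ _∷_ (interp-valueR x) (interp-valueRs xs)

        interp-valueF : ∀ k {f} (t : FTΔ Δ k f) →
                        interpF (E.evalF t) ≡ subst (λ v → M.FCar v f) (g-ground k) (EM.evalF t)
        interp-valueF k (flexΔ σ xs) =
          trans (cong (M.fopI (g ⟦ k ⟧W) σ) (interp-valueAll k xs))
                (fopI-subst (g-ground k) σ (EM.evalAll k xs))

        interp-valueAll : ∀ k {ar} (xs : All (TermΔ Δ k) ar) →
                          interpAll ⟦ k ⟧W (E.evalAll k xs) ≡
                          subst (λ v → All (M.Car v) ar) (g-ground k) (EM.evalAll k xs)
        interp-valueAll k [] = sym (subst-[] (g-ground k))
        interp-valueAll k (_∷_ {x = inj₁ r} x xs) =
          trans (cong₂ _∷_ (trans (interp-valueR x) (sym (subst-rigid (g-ground k) _)))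
                           (interp-valueAll k xs))
                (sym (subst-∷ (g-ground k) _ _))
        interp-valueAll k (_∷_ {x = inj₂ f} x xs) =
          trans (cong₂ _∷_ (interp-valueF k x) (interp-valueAll k xs))
                (sym (subst-∷ (g-ground k) _ _))

      interp-value : ∀ k s (t : TermΔ Δ k s) →
                     interp ⟦ k ⟧W s (value Δ (TW Δ W) k s t) ≡
                     subst (λ v → M.Car v s) (g-ground k) (value Δ M k s t)
      interp-value k (inj₁ r) t = trans (interp-valueR t) (sym (subst-rigid (g-ground k) _))
      interp-value k (inj₂ f) t = interp-valueF k t

  module _ (W : NomModel Δ) (reach : Reachable Δ W) where
    open HTerms Δ (NomModel.Wd W)
    private
      module E = Eval Δ (TW Δ W)

      ⟦_⟧W : NTerm Δ → NomModel.Wd W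
      ⟦ k ⟧W = ⟦_⟧ₙ Δ k W

      name : NomModel.Wd W → NTerm Δ
      name w = proj₁ (reach w)

      name-spec : ∀ w → ⟦ name w ⟧W ≡ w
      name-spec w = proj₂ (reach w)

    mutual
      preimageR : ∀ {r} → RT r → RTΔ Δ r
      preimageR (rig σ xs)      = rigΔ σ (preimageRs xs)
      preimageR (flexR w₀ σ xs) = flexRΔ (name w₀) σ (preimageAll (name w₀) xs)

      preimageRs : ∀ {ar} → All RT ar → All (RTΔ Δ) ar
      preimageRs []       = []
      preimageRs (x ∷ xs) = preimageR x ∷ preimageRs xs

      preimageF : ∀ k {w f} → FT w f → FTΔ Δ k f
      preimageF k (flex σ xs) = flexΔ σ (preimageAll k xs)

      preimageAll : ∀ k {w ar} → All (Term w) ar → All (TermΔ Δ k) ar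
      preimageAll k []                      = []
      preimageAll k (_∷_ {x = inj₁ r} x xs) = preimageR x ∷ preimageAll k xs
      preimageAll k (_∷_ {x = inj₂ f} x xs) = preimageF k x ∷ preimageAll k xs

    preimage : ∀ k s → Term ⟦ k ⟧W s → TermΔ Δ k s
    preimage k (inj₁ r) τ = preimageR τ
    preimage k (inj₂ f) τ = preimageF k τ

    mutual
      value-preimageR : ∀ {r} (τ : RT r) → E.evalR (preimageR τ) ≡ τ
      value-preimageR (rig σ xs)      = cong (rig σ) (value-preimageRs xs)
      value-preimageR (flexR w₀ σ xs) = value-preimage-flexR (name-spec w₀) σ xs

      value-preimage-flexR : ∀ {k w} (p : ⟦ k ⟧W ≡ w) {ar r} (σ : OpF ar (inj₁ r))
                             (xs : All (Term w) ar) →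
                             E.evalR (flexRΔ k σ (preimageAll k xs)) ≡ flexR w σ xs
      value-preimage-flexR {k} refl σ xs = cong (flexR ⟦ k ⟧W σ) (value-preimageAll k xs)

      value-preimageRs : ∀ {ar} (xs : All RT ar) → E.evalRs (preimageRs xs) ≡ xs
      value-preimageRs []       = refl
      value-preimageRs (x ∷ xs) = cong₂ _∷_ (value-preimageR x) (value-preimageRs xs)

      value-preimageF : ∀ k {f} (τ : FT ⟦ k ⟧W f) → E.evalF (preimageF k τ) ≡ τ
      value-preimageF k (flex σ xs) = cong (flex σ) (value-preimageAll k xs)

      value-preimageAll : ∀ k {ar} (xs : All (Term ⟦ k ⟧W) ar) →
                          E.evalAll k (preimageAll k xs) ≡ xs
      value-preimageAll k []                      = refl
      value-preimageAll k (_∷_ {x = inj₁ r} x xs) =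
        cong₂ _∷_ (value-preimageR x) (value-preimageAll k xs)
      value-preimageAll k (_∷_ {x = inj₂ f} x xs) =
        cong₂ _∷_ (value-preimageF k x) (value-preimageAll k xs)

    value-preimage : ∀ k s (τ : Term ⟦ k ⟧W s) → value Δ (TW Δ W) k s (preimage k s τ) ≡ τ
    value-preimage k (inj₁ r) τ = value-preimageR τ
    value-preimage k (inj₂ f) τ = value-preimageF k τ

    module _ (Γ : Sen Δ → Set) (Γ⊨ΓW : _⊨⊨_ Δ Γ (ΓW Δ W)) where
      ΓModel : Set₁
      ΓModel = Σ (DModel Δ) (λ M → _⊨Set_ Δ M Γ)

      worldIn : (M : DModel Δ) → NomModel.Wd W → DModel.Wd M
      worldIn M w = ⟦_⟧ₙ Δ (name w) (DModel.W M)

      worldIn-ground : ((M , _) : ΓModel) → ∀ k → ⟦_⟧ₙ Δ k (DModel.W M) ≡ worldIn M ⟦ k ⟧W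
      worldIn-ground (M , M⊨Γ) k = sym (Γ⊨ΓW M M⊨Γ (nomEq (name ⟦ k ⟧W) k) (name-spec ⟦ k ⟧W))

      ι : ((M , _) : ΓModel) → ∀ w s → Term w s → DModel.Car M (worldIn M w) s
      ι (M , _) = Interpretation.interp W M (worldIn M)

      private
        modelAt : NomModel.Wd W → ΓModel → MModel (SigΣ Δ)
        modelAt w (M , _) = DModel.M M (worldIn M w)

      Identified : ∀ w s → Rel (Term w s) (lsuc 0ℓ)
      Identified w = Kernel (DModel.M (TW Δ W) w) (modelAt w) (λ 𝕄 → ι 𝕄 w)

      Identified-isΔCongruence : IsΔCongruence Δ (TW Δ W) Identified
      Identified-isΔCongruence = record
        { congruence = λ w → Kernel-isMCongruence _ (modelAt w) (λ 𝕄 → ι 𝕄 w) λ (M , _) →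
            Interpretation.interp-isMHomomorphism W M (worldIn M) w
        ; rigid      = λ w₁ w₂ r x y → mk⇔ id id }

      ι-value : (𝕄 : ΓModel) → ∀ k s (t : TermΔ Δ k s) →
                ι 𝕄 ⟦ k ⟧W s (value Δ (TW Δ W) k s t) ≡
                subst (λ v → DModel.Car (proj₁ 𝕄) v s) (worldIn-ground 𝕄 k) (value Δ (proj₁ 𝕄) k s t)
      ι-value 𝕄@(M , _) = Interpretation.interp-value W M (worldIn M) (worldIn-ground 𝕄)

      HRel⇒Identified : ∀ {w s τ₁ τ₂} → HRel Δ Γ W w s τ₁ τ₂ → Identified w s τ₁ τ₂
      HRel⇒Identified {s = s} {τ₁} {τ₂} (k , t₁ , t₂ , Γ⊨t₁≈t₂ , refl , τ₁≡t₁ , τ₂≡t₂) 𝕄@(M , M⊨Γ) =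
        begin
          ι 𝕄 ⟦ k ⟧W s τ₁                                ≡⟨ cong (ι 𝕄 ⟦ k ⟧W s) τ₁≡t₁ ⟩
          ι 𝕄 ⟦ k ⟧W s (value Δ (TW Δ W) k s t₁)         ≡⟨ ι-value 𝕄 k s t₁ ⟩
          subst _ (worldIn-ground 𝕄 k) (value Δ M k s t₁) ≡⟨ cong (subst _ _) (Γ⊨t₁≈t₂ M M⊨Γ _ refl) ⟩
          subst _ (worldIn-ground 𝕄 k) (value Δ M k s t₂) ≡⟨ ι-value 𝕄 k s t₂ ⟨
          ι 𝕄 ⟦ k ⟧W s (value Δ (TW Δ W) k s t₂)         ≡⟨ cong (ι 𝕄 ⟦ k ⟧W s) τ₂≡t₂ ⟨
          ι 𝕄 ⟦ k ⟧W s τ₂                                ∎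
        where open ≡-Reasoning

      Identified⇒HRel-named : ∀ k {w s τ₁ τ₂} → ⟦ k ⟧W ≡ w →
                              Identified w s τ₁ τ₂ → HRel Δ Γ W w s τ₁ τ₂
      Identified⇒HRel-named k {s = s} {τ₁} {τ₂} refl τ₁~τ₂ =
        k , t₁ , t₂ , Γ⊨t₁≈t₂ , refl , sym (value-preimage k s τ₁) , sym (value-preimage k s τ₂)
        where
        t₁ t₂ : TermΔ Δ k s
        t₁ = preimage k s τ₁
        t₂ = preimage k s τ₂
        Γ⊨t₁≈t₂ : _⊨⊨_ Δ Γ (⟨_⟩ Δ (hybEq k s t₁ t₂))
        Γ⊨t₁≈t₂ M M⊨Γ _ refl = subst-injective (worldIn-ground 𝕄 k) (begin
          subst _ (worldIn-ground 𝕄 k) (value Δ M k s t₁) ≡⟨ ι-value 𝕄 k s t₁ ⟨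
          ι 𝕄 ⟦ k ⟧W s (value Δ (TW Δ W) k s t₁)         ≡⟨ cong (ι 𝕄 ⟦ k ⟧W s) (value-preimage k s τ₁) ⟩
          ι 𝕄 ⟦ k ⟧W s τ₁                                ≡⟨ τ₁~τ₂ 𝕄 ⟩
          ι 𝕄 ⟦ k ⟧W s τ₂                                ≡⟨ cong (ι 𝕄 ⟦ k ⟧W s) (value-preimage k s τ₂) ⟨
          ι 𝕄 ⟦ k ⟧W s (value Δ (TW Δ W) k s t₂)         ≡⟨ ι-value 𝕄 k s t₂ ⟩
          subst _ (worldIn-ground 𝕄 k) (value Δ M k s t₂) ∎)
          where
          open ≡-Reasoning
          𝕄 : ΓModel
          𝕄 = M , M⊨Γ

      HRel⇔Identified : ∀ w s τ₁ τ₂ → HRel Δ Γ W w s τ₁ τ₂ ⇔ Identified w s τ₁ τ₂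
      HRel⇔Identified w s τ₁ τ₂ = mk⇔ HRel⇒Identified (Identified⇒HRel-named (name w) (name-spec w))

proposition10 : (Δ : Sig) (Γ : Sen Δ → Set) (W : NomModel Δ) →
    Reachable Δ W → _⊨⊨_ Δ Γ (ΓW Δ W) →
    IsΔCongruence Δ (TW Δ W) (HRel Δ Γ W)
proposition10 Δ Γ W reach Γ⊨ΓW =
  IsΔCongruence-resp-⇔ Δ (HRel⇔Identified Δ W reach Γ Γ⊨ΓW)
                         (Identified-isΔCongruence Δ W reach Γ Γ⊨ΓW)
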